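{- Let $\mathsf{Motz}$ be the nonsymmetric sub-operad of $\mathsf{T}\mathbb{N}$ generated by the words $00$ and $010$. Then the elements of $\mathsf{Motz}$ of arity $n$ are exactly the words $x=(x_1,\dots,x_n)$ over $\mathbb{N}$ with $x_1=x_n=0$ and $|x_i-x_{i+1}|\le1$ for all $1\le i\le n-1$. Moreover, the elements of $\mathsf{Motz}$ of arity $n$ are in bijection with Motzkin paths with $n-1$ steps. Finally, $\mathsf{Motz}$ is isomorphic to the nonsymmetric operad generated by a generator $a$ of arity two and a generator $b$ of arity three subject to the four relations $a\circ_1 a = a\circ_2 a$, $a\circ_1 b = b\circ_3 a$, $b\circ_1 a = a\circ_2 b$, $b\circ_1 b = b\circ_3 b$.
   Context: $\mathbb{N}$ denotes the additive monoid of nonnegative integers. $\mathsf{T}\mathbb{N} := \biguplus_{n\ge1}\mathbb{N}^n$ is the set of nonempty words over $\mathbb{N}$, a word of length $n$ having arity $n$, with partial compositions $x\circ_i y := (x_1,\dots,x_{i-1}, x_i+y_1,\dots,x_i+y_m, x_{i+1},\dots,x_n)$ for $x$ of length $n$, $y$ of length $m$, $1\le i\le n$; its unit is the word $0$ of length $1$. The nonsymmetric sub-operad generated by a set $G$ of words is the smallest subset of $\mathsf{T}\mathbb{N}$ containing $G$ and the unit and closed under all partial compositions $\circ_i$. A Motzkin path with $k$ steps is a sequence of $k$ steps, each in $\{(1,1),(1,0),(1,-1)\}$, starting at $(0,0)$, ending on the horizontal axis and never going below it. The nonsymmetric operad generated by generators subject to relations is the quotient of the free nonsymmetric set-operad on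 these generators by the smallest operad congruence containing the relations. -}

module Defs where

open import Data.Nat using (ℕ; zero; suc; _+_; _∸_; _≤_; ∣_-_∣)
open import Data.Nat.Properties using (_≤?_)
open import Data.Integer as ℤ using (ℤ; 0ℤ; 1ℤ; -1ℤ)
open import Data.List using (List; []; _∷_; _++_; map; length; inits; last)
open import Data.List.Relation.Unary.All using (All)
open import Data.Maybe using (Maybe; just)
open import Data.Product using (Σ; _×_; ∃)
open import Data.Unit using (⊤)
open import Relation.Nullary using (yes; no)
open import Relation.Binary.PropositionalEquality using (_≡_)

-- The operad TN: nonempty words over ℕ, represented as lists
-- (arity = length).  Partial composition x ∘ᵢ y, 1-indexed
-- (meaningful for 1 ≤ i ≤ length x; junk value x otherwise).

Word : Set
Word = List ℕ

compose : Word → ℕ → Word → Word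
compose []       _             y = []
compose (x ∷ xs) zero          y = x ∷ xs
compose (x ∷ xs) (suc zero)    y = map (x +_) y ++ xs
compose (x ∷ xs) (suc (suc i)) y = x ∷ compose xs (suc i) y

unitW : Word
unitW = 0 ∷ []

data Generated (G : Word → Set) : Word → Set where
  gen  : ∀ {x} → G x → Generated G x
  unit : Generated G unitW
  comp : ∀ {x y} (i : ℕ) → 1 ≤ i → i ≤ length x →
         Generated G x → Generated G y → Generated G (compose x i y)

data MotzGen : Word → Set where
  g00  : MotzGen (0 ∷ 0 ∷ [])
  g010 : MotzGen (0 ∷ 1 ∷ 0 ∷ [])

Motz : Word → Set
Motz = Generated MotzGen

AdjacentClose : Word → Set
AdjacentClose []           = ⊤
AdjacentClose (a ∷ [])     = ⊤
AdjacentClose (a ∷ b ∷ xs) = ∣ a - b ∣ ≤ 1 × AdjacentClose (b ∷ xs)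

IsMotzWord : Word → Set
IsMotzWord x = (∃ λ xs → x ≡ 0 ∷ xs) × last x ≡ just 0 × AdjacentClose x

data Step : Set where
  up flat down : Step

stepHeight : Step → ℤ
stepHeight up   = 1ℤ
stepHeight flat = 0ℤ
stepHeight down = -1ℤ

height : List Step → ℤ
height []       = 0ℤ
height (s ∷ ss) = stepHeight s ℤ.+ height ss

IsMotzkinPath : ℕ → List Step → Set
IsMotzkinPath k p = length p ≡ k × All (λ q → 0ℤ ℤ.≤ height q) (inits p) × height p ≡ 0ℤ

-- The free nonsymmetric operad on a (arity 2) and b (arity 3):
-- planar trees whose internal nodes are labelled a or b.

data Tree : Set where
  leaf  : Tree
  nodeA : Tree → Tree → Tree
  nodeB : Tree → Tree → Tree → Tree

arity : Tree → ℕ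
arity leaf          = 1
arity (nodeA l r)   = arity l + arity r
arity (nodeB l m r) = arity l + arity m + arity r

-- Partial composition: graft u onto the i-th leaf (1-indexed) of t
-- (junk: t unchanged if i is out of range).
graft : Tree → ℕ → Tree → Tree
graft leaf (suc zero) u = u
graft leaf _ u = leaf
graft (nodeA l r) i u with i ≤? arity l
... | yes _ = nodeA (graft l i u) r
... | no  _ = nodeA l (graft r (i ∸ arity l) u)
graft (nodeB l m r) i u with i ≤? arity l
... | yes _ = nodeB (graft l i u) m r
... | no  _ with i ∸ arity l ≤? arity m
...   | yes _ = nodeB l (graft m (i ∸ arity l) u) r
...   | no  _ = nodeB l m (graft r (i ∸ arity l ∸ arity m) u)

a b : Tree
a = nodeA leaf leaf
b = nodeB leaf leaf leaf

data _≈_ : Tree → Tree → Set where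
  ≈-refl  : ∀ {s} → s ≈ s
  ≈-sym   : ∀ {s t} → s ≈ t → t ≈ s
  ≈-trans : ∀ {s t u} → s ≈ t → t ≈ u → s ≈ u
  rel₁ : graft a 1 a ≈ graft a 2 a
  rel₂ : graft a 1 b ≈ graft b 3 a
  rel₃ : graft b 1 a ≈ graft a 2 b
  rel₄ : graft b 1 b ≈ graft b 3 b
  congˡ : ∀ {s t} (i : ℕ) (u : Tree) → 1 ≤ i → i ≤ arity s →
          s ≈ t → graft s i u ≈ graft t i u
  congʳ : ∀ {s t} (u : Tree) (i : ℕ) → 1 ≤ i → i ≤ arity u →
          s ≈ t → graft u i s ≈ graft u i t

-- An isomorphism of nonsymmetric operads (free operad / ≈) ≅ Motz,
-- presented by a map φ on trees: an arity-preserving operad morphism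
-- into TN landing in Motz, surjective onto Motz, whose kernel is ≈.
IsPresentationIso : (Tree → Word) → Set
IsPresentationIso φ =
    (∀ t → length (φ t) ≡ arity t)
  × φ leaf ≡ unitW
  × (∀ s i t → 1 ≤ i → i ≤ arity s → φ (graft s i t) ≡ compose (φ s) i (φ t))
  × (∀ t → Motz (φ t))
  × (∀ x → Motz x → ∃ λ t → φ t ≡ x)
  × (∀ s t → φ s ≡ φ t → s ≈ t)
  × (∀ s t → s ≈ t → φ s ≡ φ t)

module Submission where

-- Everything is organised around WALKS: words whose consecutive letters
-- differ by at most one, each step being a rise, a level step or a fall
-- (a 'Move').  A walk from 0 to 0 is exactly a Motzkin word, and the list
-- of its moves is exactly a Motzkin path, so parts 1 and 2 follow once
-- Motz is shown to consist of the walks from 0 to 0.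
--
-- Every walk lies in Motz: a walk
-- from c to 0 behind the staircase 0 1 … (c-1) arises from a shorter one
-- by inserting 00 (level step) or 010 (fall) with a partial composition.
-- Conversely, the realization φ of the free operad on a (arity 2) and b
-- (arity 3), with a ↦ 00 and b ↦ 010, is an operad morphism whose images
-- are walks, and Motz is exactly its image.
--
-- For the presentation (part 3) it remains to compute the kernel of φ:
-- the four relations are associativity laws, so every tree is equivalent
-- to a right comb; φ maps the relations to equalities and is injective on
-- right combs, so its kernel is ≈.

open import Defs
open import Data.Nat using (ℕ; zero; suc; _+_; _∸_; _≤_; _<_; z≤n; s≤s; ∣_-_∣)
open import Data.Nat.Properties
  using (_≤?_; +-identityʳ; +-comm; +-assoc; ≤-refl; ≤-trans; m≤m+n; ≰⇒>;
         m<n⇒0<n∸m; m≤n+o⇒m∸n≤o; m<m+n; 0<1+n; suc-injective)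
open import Data.List using (List; []; _∷_; _++_; map; length; last; inits; upTo)
open import Data.List.Properties
  using (++-assoc; ++-identityʳ; map-++; map-∘; map-id; length-++; length-map; ∷-injective; ∷-injectiveʳ; upTo-∷ʳ)
open import Data.List.Relation.Unary.All as All using (All; []; _∷_)
open import Data.List.Relation.Unary.All.Properties using (map⁺; map⁻)
open import Data.Product using (Σ; _×_; ∃; _,_; proj₁; proj₂; map₂)
open import Data.Unit using (tt)
open import Data.Maybe using (just)
open import Data.Empty using (⊥-elim)
open import Data.Integer as ℤ using (0ℤ; +≤+)
import Data.Integer.Properties as ℤP
open import Function.Bundles using (_⇔_; mk⇔)
open import Relation.Binary.PropositionalEquality
open import Relation.Nullary using (yes; no; ¬_)
open ≡-Reasoning

compose-++ˡ : ∀ u v {n} i y → length u ≡ n → i ≤ n →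
              compose (u ++ v) i y ≡ compose u i y ++ v
compose-++ˡ [] []      zero y refl z≤n = refl
compose-++ˡ [] (_ ∷ _) zero y refl z≤n = refl
compose-++ˡ (x ∷ u) v zero          y refl _ = refl
compose-++ˡ (x ∷ u) v (suc zero)    y refl _ = sym (++-assoc (map (x +_) y) u v)
compose-++ˡ (x ∷ u) v (suc (suc i)) y refl (s≤s i≤n) =
  cong (x ∷_) (compose-++ˡ u v (suc i) y refl i≤n)

compose-++ʳ : ∀ u v {n} i y → length u ≡ n → n < i →
              compose (u ++ v) i y ≡ u ++ compose v (i ∸ n) y
compose-++ʳ []           v i             y refl _ = refl
compose-++ʳ (x ∷ [])     v (suc zero)    y refl (s≤s ())
compose-++ʳ (x ∷ [])     v (suc (suc i)) y refl _ = refl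
compose-++ʳ (x ∷ x′ ∷ u) v (suc (suc i)) y refl (s≤s n<i) =
  cong (x ∷_) (compose-++ʳ (x′ ∷ u) v (suc i) y refl n<i)

compose-map-suc : ∀ u i y → compose (map suc u) i y ≡ map suc (compose u i y)
compose-map-suc []      i             y = refl
compose-map-suc (x ∷ u) zero          y = refl
compose-map-suc (x ∷ u) (suc zero)    y = begin
  map (suc x +_) y ++ map suc u          ≡⟨ cong (_++ map suc u) (map-∘ y) ⟩
  map suc (map (x +_) y) ++ map suc u    ≡⟨ sym (map-++ suc (map (x +_) y) u) ⟩
  map suc (map (x +_) y ++ u)            ∎
compose-map-suc (x ∷ u) (suc (suc i)) y = cong (suc x ∷_) (compose-map-suc u (suc i) y)

compose-at : ∀ u c rest y →
             compose (u ++ c ∷ rest) (suc (length u)) y ≡ u ++ map (c +_) y ++ rest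
compose-at []      c rest y = refl
compose-at (x ∷ u) c rest y = cong (x ∷_) (compose-at u c rest y)

Motz-insert : ∀ u c rest {y} → Motz (u ++ c ∷ rest) → Motz y →
              Motz (u ++ map (c +_) y ++ rest)
Motz-insert u c rest {y} mx my =
  subst Motz (compose-at u c rest y) (comp (suc (length u)) (s≤s z≤n) inside mx my)
  where
  inside : suc (length u) ≤ length (u ++ c ∷ rest)
  inside = subst (suc (length u) ≤_) (sym (length-++ u)) (m<m+n (length u) 0<1+n)

data Move : ℕ → Step → ℕ → Set where
  rise  : ∀ {a} → Move a up (suc a)
  level : ∀ {a} → Move a flat a
  fall  : ∀ {a} → Move (suc a) down a

move-suc : ∀ {a s b} → Move a s b → Move (suc a) s (suc b)
move-suc rise  = rise
move-suc level = level
move-suc fall  = fall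

move-close : ∀ {a s b} → Move a s b → ∣ a - b ∣ ≤ 1
move-close (rise  {zero})  = ≤-refl
move-close (rise  {suc a}) = move-close (rise {a})
move-close (level {zero})  = z≤n
move-close (level {suc a}) = move-close (level {a})
move-close (fall  {zero})  = ≤-refl
move-close (fall  {suc a}) = move-close (fall {a})

close-move : ∀ a b → ∣ a - b ∣ ≤ 1 → ∃ λ s → Move a s b
close-move zero          zero          _        = flat , level
close-move zero          (suc zero)    _        = up , rise
close-move zero          (suc (suc b)) (s≤s ())
close-move (suc zero)    zero          _        = down , fall
close-move (suc (suc a)) zero          (s≤s ())
close-move (suc a)       (suc b)       d        = map₂ move-suc (close-move a b d)

move-unique : ∀ {a s s′ b} → Move a s b → Move a s′ b → s ≡ s′
move-unique rise  rise  = refl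
move-unique level level = refl
move-unique fall  fall  = refl

data Walk : ℕ → Word → ℕ → Set where
  stop : ∀ {a} → Walk a (a ∷ []) a
  _▸_  : ∀ {a s b w c} → Move a s b → Walk b w c → Walk a (a ∷ w) c

infixr 5 _▸_

steps : ∀ {a w c} → Walk a w c → List Step
steps stop    = []
steps (_▸_ {s = s} _ d) = s ∷ steps d

walk-head : ∀ {a w c} → Walk a w c → ∃ λ xs → w ≡ a ∷ xs
walk-head stop    = _ , refl
walk-head (_ ▸ _) = _ , refl

walk-++ : ∀ {a u c s b v d} → Walk a u c → Move c s b → Walk b v d → Walk a (u ++ v) d
walk-++ stop      m q = m ▸ q
walk-++ (m′ ▸ p) m q = m′ ▸ walk-++ p m q

walk-suc : ∀ {a u c} → Walk a u c → Walk (suc a) (map suc u) (suc c)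
walk-suc stop    = stop
walk-suc (m ▸ p) = move-suc m ▸ walk-suc p

walk⇒MotzWord : ∀ {w} → Walk 0 w 0 → IsMotzWord w
walk⇒MotzWord d = walk-head d , walk-last d , walk-close d
  where
  walk-last : ∀ {a w c} → Walk a w c → last w ≡ just c
  walk-last stop              = refl
  walk-last (_ ▸ stop)        = refl
  walk-last (_ ▸ d@(_ ▸ _))   = walk-last d
  walk-close : ∀ {a w c} → Walk a w c → AdjacentClose w
  walk-close stop             = tt
  walk-close (m ▸ stop)       = move-close m , tt
  walk-close (m ▸ d@(_ ▸ _))  = move-close m , walk-close d

MotzWord⇒walk : ∀ {w} → IsMotzWord w → Walk 0 w 0
MotzWord⇒walk ((xs , refl) , l , ac) = from-close 0 xs l ac
  where
  from-close : ∀ a xs {c} → last (a ∷ xs) ≡ just c → AdjacentClose (a ∷ xs) → Walk a (a ∷ xs) c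
  from-close a []       refl _         = stop
  from-close a (b ∷ xs) l    (ab , ac) = proj₂ (close-move a b ab) ▸ from-close b xs l ac

upTo-suc-++ : ∀ c v → upTo (suc c) ++ v ≡ upTo c ++ c ∷ v
upTo-suc-++ c v = trans (cong (_++ v) (sym (upTo-∷ʳ c))) (++-assoc (upTo c) (c ∷ []) v)

-- Induction on a walk from c to 0, kept behind the staircase 0 1 … (c-1):
-- a rise only moves a letter into the staircase, a level step inserts 00
-- and a fall inserts 010 at the last letter of the staircase.
staircase-walk-Motz : ∀ {c v} → Walk c v 0 → Motz (upTo c ++ v)
staircase-walk-Motz stop = unit
staircase-walk-Motz (rise {c} ▸ d) = subst Motz (upTo-suc-++ c _) (staircase-walk-Motz d)
staircase-walk-Motz (level {c} ▸ d) with walk-head d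
... | w , refl =
  subst Motz (cong (λ z → upTo c ++ z ∷ z ∷ w) (+-identityʳ c))
        (Motz-insert (upTo c) c w (staircase-walk-Motz d) (gen g00))
staircase-walk-Motz (fall {b} ▸ d) with walk-head d
... | w , refl =
  subst Motz (trans (cong₂ (λ z z′ → upTo b ++ z ∷ z′ ∷ z ∷ w) (+-identityʳ b) (+-comm b 1))
                    (sym (upTo-suc-++ b (suc b ∷ b ∷ w))))
        (Motz-insert (upTo b) b w (staircase-walk-Motz d) (gen g010))

walk-Motz : ∀ {w} → Walk 0 w 0 → Motz w
walk-Motz = staircase-walk-Motz

-- The realization of the free operad on a and b in TN: a ↦ 00 and
-- b ↦ 010, extended to trees: the words of the three subtrees
-- of a node are concatenated, for b the middle one raised by one.
φ : Tree → Word
φ leaf          = 0 ∷ []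
φ (nodeA l r)   = φ l ++ φ r
φ (nodeB l m r) = φ l ++ map suc (φ m) ++ φ r

φ-length : ∀ t → length (φ t) ≡ arity t
φ-length leaf        = refl
φ-length (nodeA l r) = trans (length-++ (φ l)) (cong₂ _+_ (φ-length l) (φ-length r))
φ-length (nodeB l m r) = begin
  length (φ l ++ map suc (φ m) ++ φ r)               ≡⟨ length-++ (φ l) ⟩
  length (φ l) + length (map suc (φ m) ++ φ r)       ≡⟨ cong (length (φ l) +_) (length-++ (map suc (φ m))) ⟩
  length (φ l) + (length (map suc (φ m)) + length (φ r))
    ≡⟨ cong (λ y → length (φ l) + (y + length (φ r))) (length-map suc (φ m)) ⟩
  length (φ l) + (length (φ m) + length (φ r))
    ≡⟨ cong₂ (λ x y → x + (y + length (φ r))) (φ-length l) (φ-length m) ⟩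
  arity l + (arity m + length (φ r))                 ≡⟨ cong (λ z → arity l + (arity m + z)) (φ-length r) ⟩
  arity l + (arity m + arity r)                      ≡⟨ sym (+-assoc (arity l) (arity m) (arity r)) ⟩
  arity l + arity m + arity r                        ∎

raised-length : ∀ t → length (map suc (φ t)) ≡ arity t
raised-length t = trans (length-map suc (φ t)) (φ-length t)

-- Each φ t is a walk from 0 to 0: the pieces are glued by a level step
-- (a-nodes) or by a rise into and a fall out of the raised middle word.
φ-walk : ∀ t → Walk 0 (φ t) 0
φ-walk leaf          = stop
φ-walk (nodeA l r)   = walk-++ (φ-walk l) level (φ-walk r)
φ-walk (nodeB l m r) = walk-++ (φ-walk l) rise (walk-++ (walk-suc (φ-walk m)) fall (φ-walk r))

Motz-φ : ∀ t → Motz (φ t)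
Motz-φ t = walk-Motz (φ-walk t)

past-start : ∀ {i n} → ¬ (i ≤ n) → 1 ≤ i ∸ n
past-start i≰n = m<n⇒0<n∸m (≰⇒> i≰n)

φ-graft : ∀ s i t → 1 ≤ i → i ≤ arity s → φ (graft s i t) ≡ compose (φ s) i (φ t)
φ-graft leaf (suc zero)    t _ _ = sym (trans (++-identityʳ _) (map-id (φ t)))
φ-graft leaf (suc (suc i)) t _ (s≤s ())
φ-graft (nodeA l r) i t 1≤i i≤n with i ≤? arity l
... | yes i≤l = begin
  φ (graft l i t) ++ φ r               ≡⟨ cong (_++ φ r) (φ-graft l i t 1≤i i≤l) ⟩
  compose (φ l) i (φ t) ++ φ r         ≡⟨ sym (compose-++ˡ (φ l) (φ r) i (φ t) (φ-length l) i≤l) ⟩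
  compose (φ l ++ φ r) i (φ t)         ∎
... | no i≰l = begin
  φ l ++ φ (graft r j t)               ≡⟨ cong (φ l ++_) (φ-graft r j t (past-start i≰l) (m≤n+o⇒m∸n≤o i (arity l) i≤n)) ⟩
  φ l ++ compose (φ r) j (φ t)         ≡⟨ sym (compose-++ʳ (φ l) (φ r) i (φ t) (φ-length l) (≰⇒> i≰l)) ⟩
  compose (φ l ++ φ r) i (φ t)         ∎
  where j = i ∸ arity l
φ-graft (nodeB l m r) i t 1≤i i≤n with i ≤? arity l
... | yes i≤l = begin
  φ (graft l i t) ++ rest              ≡⟨ cong (_++ rest) (φ-graft l i t 1≤i i≤l) ⟩
  compose (φ l) i (φ t) ++ rest        ≡⟨ sym (compose-++ˡ (φ l) rest i (φ t) (φ-length l) i≤l) ⟩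
  compose (φ l ++ rest) i (φ t)        ∎
  where rest = map suc (φ m) ++ φ r
... | no i≰l with i ∸ arity l ≤? arity m
...   | yes j≤m = begin
  φ l ++ map suc (φ (graft m j t)) ++ φ r          ≡⟨ cong (λ z → φ l ++ map suc z ++ φ r) (φ-graft m j t (past-start i≰l) j≤m) ⟩
  φ l ++ map suc (compose (φ m) j (φ t)) ++ φ r    ≡⟨ cong (λ z → φ l ++ z ++ φ r) (sym (compose-map-suc (φ m) j (φ t))) ⟩
  φ l ++ compose (map suc (φ m)) j (φ t) ++ φ r    ≡⟨ cong (φ l ++_) (sym (compose-++ˡ (map suc (φ m)) (φ r) j (φ t) (raised-length m) j≤m)) ⟩
  φ l ++ compose (map suc (φ m) ++ φ r) j (φ t)    ≡⟨ sym (compose-++ʳ (φ l) _ i (φ t) (φ-length l) (≰⇒> i≰l)) ⟩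
  compose (φ l ++ map suc (φ m) ++ φ r) i (φ t)    ∎
  where j = i ∸ arity l
...   | no j≰m = begin
  φ l ++ map suc (φ m) ++ φ (graft r k t)          ≡⟨ cong (λ z → φ l ++ map suc (φ m) ++ z) (φ-graft r k t (past-start j≰m) k≤r) ⟩
  φ l ++ map suc (φ m) ++ compose (φ r) k (φ t)    ≡⟨ cong (φ l ++_) (sym (compose-++ʳ (map suc (φ m)) (φ r) j (φ t) (raised-length m) (≰⇒> j≰m))) ⟩
  φ l ++ compose (map suc (φ m) ++ φ r) j (φ t)    ≡⟨ sym (compose-++ʳ (φ l) _ i (φ t) (φ-length l) (≰⇒> i≰l)) ⟩
  compose (φ l ++ map suc (φ m) ++ φ r) i (φ t)    ∎
  where
  j = i ∸ arity l
  k = j ∸ arity m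
  k≤r : k ≤ arity r
  k≤r = m≤n+o⇒m∸n≤o j (arity m)
          (m≤n+o⇒m∸n≤o i (arity l) (subst (i ≤_) (+-assoc (arity l) (arity m) (arity r)) i≤n))

-- Every element of Motz is some φ t: the generators and the unit are
-- images, and images are closed under composition since φ is a morphism.
φ-onto : ∀ x → Motz x → ∃ λ t → φ t ≡ x
φ-onto _ (gen g00)  = a , refl
φ-onto _ (gen g010) = b , refl
φ-onto _ unit       = leaf , refl
φ-onto _ (comp i 1≤i i≤n mx my) with φ-onto _ mx | φ-onto _ my
... | s , refl | t , refl = graft s i t , φ-graft s i t 1≤i (subst (i ≤_) (φ-length s) i≤n)

Motz-walk : ∀ {x} → Motz x → Walk 0 x 0
Motz-walk {x} mx with φ-onto x mx
... | t , refl = φ-walk t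

Motz⇔MotzWord : ∀ x → Motz x ⇔ IsMotzWord x
Motz⇔MotzWord x = mk⇔ (λ mx → walk⇒MotzWord (Motz-walk mx)) (λ w → walk-Motz (MotzWord⇒walk w))

-- φ identifies both sides of each relation (they reduce to the same
-- word), hence everything the congruence generated by them identifies.
φ-sound : ∀ s t → s ≈ t → φ s ≡ φ t
φ-sound s .s ≈-refl          = refl
φ-sound s t  (≈-sym e)       = sym (φ-sound t s e)
φ-sound s t  (≈-trans e e′)  = trans (φ-sound s _ e) (φ-sound _ t e′)
φ-sound _ _  rel₁ = refl
φ-sound _ _  rel₂ = refl
φ-sound _ _  rel₃ = refl
φ-sound _ _  rel₄ = refl
φ-sound _ _  (congˡ {s} {t} i u 1≤i i≤s e) = begin
  φ (graft s i u)           ≡⟨ φ-graft s i u 1≤i i≤s ⟩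
  compose (φ s) i (φ u)     ≡⟨ cong (λ z → compose z i (φ u)) φs≡φt ⟩
  compose (φ t) i (φ u)     ≡⟨ sym (φ-graft t i u 1≤i i≤t) ⟩
  φ (graft t i u)           ∎
  where
  φs≡φt = φ-sound s t e
  i≤t : i ≤ arity t
  i≤t = subst (i ≤_) (trans (sym (φ-length s)) (trans (cong length φs≡φt) (φ-length t))) i≤s
φ-sound _ _  (congʳ {s} {t} u i 1≤i i≤u e) = begin
  φ (graft u i s)           ≡⟨ φ-graft u i s 1≤i i≤u ⟩
  compose (φ u) i (φ s)     ≡⟨ cong (compose (φ u) i) (φ-sound s t e) ⟩
  compose (φ u) i (φ t)     ≡⟨ sym (φ-graft u i t 1≤i i≤u) ⟩
  φ (graft u i t)           ∎

arity-positive : ∀ t → 1 ≤ arity t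
arity-positive leaf          = ≤-refl
arity-positive (nodeA l r)   = ≤-trans (arity-positive l) (m≤m+n (arity l) (arity r))
arity-positive (nodeB l m r) =
  ≤-trans (arity-positive l) (≤-trans (m≤m+n (arity l) (arity m)) (m≤m+n (arity l + arity m) (arity r)))

-- ≈ is compatible with the tree constructors (graft the subtrees one by
-- one into the leaves of a or b).
cong-nodeA : ∀ {x x′ y y′} → x ≈ x′ → y ≈ y′ → nodeA x y ≈ nodeA x′ y′
cong-nodeA {x} {x′} {y} ex ey =
  ≈-trans (congʳ (nodeA leaf y) 1 ≤-refl (arity-positive (nodeA leaf y)) ex)
          (congˡ 1 x′ ≤-refl (arity-positive (nodeA leaf y))
                 (congʳ a 2 (s≤s z≤n) ≤-refl ey))

cong-nodeB : ∀ {x x′ y y′ z z′} → x ≈ x′ → y ≈ y′ → z ≈ z′ → nodeB x y z ≈ nodeB x′ y′ z′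
cong-nodeB {x} {x′} {y} {y′} {z} ex ey ez =
  ≈-trans (congʳ (nodeB leaf y z) 1 ≤-refl (arity-positive (nodeB leaf y z)) ex)
          (congˡ 1 x′ ≤-refl (arity-positive (nodeB leaf y z))
            (≈-trans (congʳ (nodeB leaf leaf z) 2 (s≤s z≤n) (s≤s (s≤s z≤n)) ey)
                     (congˡ 2 y′ (s≤s z≤n) (s≤s (s≤s z≤n))
                        (congʳ b 3 (s≤s z≤n) ≤-refl ez))))

-- The four relations with arbitrary subtrees in the leaves: each is a
-- rebracketing that moves the left child of the root to the right.
private
  1≤ : ∀ {n} → 1 ≤ suc n
  1≤ = s≤s z≤n

  ≤+ : ∀ k {n} → k ≤ k + n
  ≤+ k = m≤m+n k _

assocAA : ∀ {x y z} → nodeA (nodeA x y) z ≈ nodeA x (nodeA y z)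
assocAA {x} {y} {z} =
  congˡ 1 x 1≤ (≤+ 1) (congˡ 2 y 1≤ (≤+ 2) (congˡ 3 z 1≤ ≤-refl rel₁))

assocAB : ∀ {x y z w} → nodeA (nodeB x y z) w ≈ nodeB x y (nodeA z w)
assocAB {x} {y} {z} {w} =
  congˡ 1 x 1≤ (≤+ 1) (congˡ 2 y 1≤ (≤+ 2) (congˡ 3 z 1≤ (≤+ 3) (congˡ 4 w 1≤ ≤-refl rel₂)))

assocBA : ∀ {x y z w} → nodeB (nodeA x y) z w ≈ nodeA x (nodeB y z w)
assocBA {x} {y} {z} {w} =
  congˡ 1 x 1≤ (≤+ 1) (congˡ 2 y 1≤ (≤+ 2) (congˡ 3 z 1≤ (≤+ 3) (congˡ 4 w 1≤ ≤-refl rel₃)))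

assocBB : ∀ {x y z u v} → nodeB (nodeB x y z) u v ≈ nodeB x y (nodeB z u v)
assocBB {x} {y} {z} {u} {v} =
  congˡ 1 x 1≤ (≤+ 1) (congˡ 2 y 1≤ (≤+ 2) (congˡ 3 z 1≤ (≤+ 3) (congˡ 4 u 1≤ (≤+ 4) (congˡ 5 v 1≤ ≤-refl rel₄))))

data RightComb : Tree → Set where
  leaf  : RightComb leaf
  combA : ∀ {r} → RightComb r → RightComb (nodeA leaf r)
  combB : ∀ {m r} → RightComb m → RightComb r → RightComb (nodeB leaf m r)

-- nodeA l r and nodeB l m r rebracketed along the right spine of l.
appendA : Tree → Tree → Tree
appendA leaf          r = nodeA leaf r
appendA (nodeA x l)   r = nodeA x (appendA l r)
appendA (nodeB x y l) r = nodeB x y (appendA l r)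

appendB : Tree → Tree → Tree → Tree
appendB leaf          m r = nodeB leaf m r
appendB (nodeA x l)   m r = nodeA x (appendB l m r)
appendB (nodeB x y l) m r = nodeB x y (appendB l m r)

appendA-≈ : ∀ l r → nodeA l r ≈ appendA l r
appendA-≈ leaf          r = ≈-refl
appendA-≈ (nodeA x l)   r = ≈-trans assocAA (cong-nodeA ≈-refl (appendA-≈ l r))
appendA-≈ (nodeB x y l) r = ≈-trans assocAB (cong-nodeB ≈-refl ≈-refl (appendA-≈ l r))

appendB-≈ : ∀ l m r → nodeB l m r ≈ appendB l m r
appendB-≈ leaf          m r = ≈-refl
appendB-≈ (nodeA x l)   m r = ≈-trans assocBA (cong-nodeA ≈-refl (appendB-≈ l m r))
appendB-≈ (nodeB x y l) m r = ≈-trans assocBB (cong-nodeB ≈-refl ≈-refl (appendB-≈ l m r))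

appendA-comb : ∀ {l r} → RightComb l → RightComb r → RightComb (appendA l r)
appendA-comb leaf        cr = combA cr
appendA-comb (combA cl)  cr = combA (appendA-comb cl cr)
appendA-comb (combB cm cl) cr = combB cm (appendA-comb cl cr)

appendB-comb : ∀ {l m r} → RightComb l → RightComb m → RightComb r → RightComb (appendB l m r)
appendB-comb leaf          cm cr = combB cm cr
appendB-comb (combA cl)    cm cr = combA (appendB-comb cl cm cr)
appendB-comb (combB cy cl) cm cr = combB cy (appendB-comb cl cm cr)

normalize : Tree → Tree
normalize leaf          = leaf
normalize (nodeA l r)   = appendA (normalize l) (normalize r)
normalize (nodeB l m r) = appendB (normalize l) (normalize m) (normalize r)

normalize-≈ : ∀ t → t ≈ normalize t
normalize-≈ leaf          = ≈-refl
normalize-≈ (nodeA l r)   =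
  ≈-trans (cong-nodeA (normalize-≈ l) (normalize-≈ r)) (appendA-≈ (normalize l) (normalize r))
normalize-≈ (nodeB l m r) =
  ≈-trans (cong-nodeB (normalize-≈ l) (normalize-≈ m) (normalize-≈ r))
          (appendB-≈ (normalize l) (normalize m) (normalize r))

normalize-comb : ∀ t → RightComb (normalize t)
normalize-comb leaf          = leaf
normalize-comb (nodeA l r)   = appendA-comb (normalize-comb l) (normalize-comb r)
normalize-comb (nodeB l m r) = appendB-comb (normalize-comb l) (normalize-comb m) (normalize-comb r)

-- A raised word is told apart from what follows by the first letter 0.
split-raised : ∀ u u′ {v v′} → (∃ λ xs → v ≡ 0 ∷ xs) → (∃ λ xs → v′ ≡ 0 ∷ xs) →
               map suc u ++ v ≡ map suc u′ ++ v′ → u ≡ u′ × v ≡ v′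
split-raised []      []       _          _          e = refl , e
split-raised []      (_ ∷ _)  (_ , refl) _          ()
split-raised (_ ∷ _) []       _          (_ , refl) ()
split-raised (x ∷ u) (x′ ∷ u′) hv hv′ e with ∷-injective e
... | sx≡sx′ , e′ with split-raised u u′ hv hv′ e′
...   | u≡u′ , v≡v′ = cong₂ _∷_ (suc-injective sx≡sx′) u≡u′ , v≡v′

φ-starts-0 : ∀ t → ∃ λ xs → φ t ≡ 0 ∷ xs
φ-starts-0 t = walk-head (φ-walk t)

-- In φ (nodeA leaf r) = 0 ∷ map suc [] ++ φ r and
-- φ (nodeB leaf m r) = 0 ∷ map suc (φ m) ++ φ r the blocks can be recovered.
split-tail : ∀ u u′ r r′ → map suc u ++ φ r ≡ map suc u′ ++ φ r′ → u ≡ u′ × φ r ≡ φ r′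
split-tail u u′ r r′ = split-raised u u′ (φ-starts-0 r) (φ-starts-0 r′)

nonempty-tail : ∀ u t → ¬ (u ++ φ t ≡ [])
nonempty-tail (_ ∷ _) t ()
nonempty-tail []      t e with φ-starts-0 t
... | xs , e′ with trans (sym e′) e
...   | ()

φ-comb-injective : ∀ {s t} → RightComb s → RightComb t → φ s ≡ φ t → s ≡ t
φ-comb-injective leaf leaf _ = refl
φ-comb-injective leaf (combA {r} _) e = ⊥-elim (nonempty-tail [] r (sym (∷-injectiveʳ e)))
φ-comb-injective leaf (combB {m} {r} _ _) e =
  ⊥-elim (nonempty-tail (map suc (φ m)) r (sym (∷-injectiveʳ e)))
φ-comb-injective (combA {r} _) leaf e = ⊥-elim (nonempty-tail [] r (∷-injectiveʳ e))
φ-comb-injective (combB {m} {r} _ _) leaf e =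
  ⊥-elim (nonempty-tail (map suc (φ m)) r (∷-injectiveʳ e))
φ-comb-injective (combA cr) (combA cr′) e =
  cong (nodeA leaf) (φ-comb-injective cr cr′ (∷-injectiveʳ e))
φ-comb-injective (combA {r} _) (combB {m′} {r′} _ _) e =
  ⊥-elim (nonempty-tail [] m′ (sym (proj₁ (split-tail [] (φ m′) r r′ (∷-injectiveʳ e)))))
φ-comb-injective (combB {m} {r} _ _) (combA {r′} _) e =
  ⊥-elim (nonempty-tail [] m (proj₁ (split-tail (φ m) [] r r′ (∷-injectiveʳ e))))
φ-comb-injective (combB {m} {r} cm cr) (combB {m′} {r′} cm′ cr′) e
  with split-tail (φ m) (φ m′) r r′ (∷-injectiveʳ e)
... | φm≡φm′ , φr≡φr′ =
  cong₂ (nodeB leaf) (φ-comb-injective cm cm′ φm≡φm′) (φ-comb-injective cr cr′ φr≡φr′)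

-- Trees with the same image have equivalent, hence equal, normal forms.
φ-kernel : ∀ s t → φ s ≡ φ t → s ≈ t
φ-kernel s t e = ≈-trans (normalize-≈ s) (subst (_≈ t) (sym same-normal-form) (≈-sym (normalize-≈ t)))
  where
  same-normal-form : normalize s ≡ normalize t
  same-normal-form = φ-comb-injective (normalize-comb s) (normalize-comb t) (begin
    φ (normalize s)   ≡⟨ sym (φ-sound s (normalize s) (normalize-≈ s)) ⟩
    φ s               ≡⟨ e ⟩
    φ t               ≡⟨ φ-sound t (normalize t) (normalize-≈ t) ⟩
    φ (normalize t)   ∎)

φ-presentation : IsPresentationIso φ
φ-presentation = φ-length , refl , φ-graft , Motz-φ , φ-onto , φ-kernel , φ-sound

-- The height reached by a step (a descent below 0 has no meaning for
-- Motzkin paths; its value is irrelevant).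
nextHeight : ℕ → Step → ℕ
nextHeight h       up   = suc h
nextHeight h       flat = h
nextHeight zero    down = 0
nextHeight (suc h) down = h

heights : ℕ → List Step → Word
heights h []      = h ∷ []
heights h (s ∷ p) = h ∷ heights (nextHeight h s) p

heights-length : ∀ h p → length (heights h p) ≡ suc (length p)
heights-length h []      = refl
heights-length h (s ∷ p) = cong suc (heights-length (nextHeight h s) p)

AboveFrom : ℕ → List Step → Set
AboveFrom h p = All (λ q → 0ℤ ℤ.≤ ℤ.+ h ℤ.+ height q) (inits p)

move-height : ∀ {a s b} → Move a s b → ∀ z → ℤ.+ a ℤ.+ (stepHeight s ℤ.+ z) ≡ ℤ.+ b ℤ.+ z
move-height {a} {s} m z = trans (sym (ℤP.+-assoc (ℤ.+ a) (stepHeight s) z)) (cong (ℤ._+ z) (one-step m))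
  where
  one-step : ∀ {a s b} → Move a s b → ℤ.+ a ℤ.+ stepHeight s ≡ ℤ.+ b
  one-step {a} rise  = cong ℤ.+_ (+-comm a 1)
  one-step {a} level = cong ℤ.+_ (+-identityʳ a)
  one-step     fall  = refl

above-∷ : ∀ h s p → AboveFrom h (s ∷ p) → Move h s (nextHeight h s) × AboveFrom (nextHeight h s) p
above-∷ h s p (_ ∷ above) = first-move h s above , All.map (λ {q} → shifted {q}) (map⁻ above)
  where
  first-move : ∀ h s → All (λ q → 0ℤ ℤ.≤ ℤ.+ h ℤ.+ height q) (map (s ∷_) (inits p)) →
               Move h s (nextHeight h s)
  first-move h       up   _           = rise
  first-move h       flat _           = level
  first-move (suc h) down _           = fall
  first-move zero    down (() ∷ _)   -- the prefix [down] would reach -1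
  shifted : ∀ {q} → 0ℤ ℤ.≤ ℤ.+ h ℤ.+ (stepHeight s ℤ.+ height q) → 0ℤ ℤ.≤ ℤ.+ nextHeight h s ℤ.+ height q
  shifted {q} = subst (0ℤ ℤ.≤_) (move-height (first-move h s above) (height q))

above⇒walk : ∀ h p c → AboveFrom h p → ℤ.+ h ℤ.+ height p ≡ ℤ.+ c →
             Σ (Walk h (heights h p) c) λ d → steps d ≡ p
above⇒walk h [] c _ e with ℤP.+-injective e
... | h+0≡c rewrite +-identityʳ h | h+0≡c = stop , refl
above⇒walk h (s ∷ p) c above e with above-∷ h s p above
... | m , above′ with above⇒walk (nextHeight h s) p c above′ (trans (sym (move-height m (height p))) e)
...   | d , steps≡p = m ▸ d , cong (s ∷_) steps≡p

walk⇒above : ∀ {a w c} (d : Walk a w c) → AboveFrom a (steps d) × ℤ.+ a ℤ.+ height (steps d) ≡ ℤ.+ c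
walk⇒above {a} stop    = +≤+ z≤n ∷ [] , cong ℤ.+_ (+-identityʳ a)
walk⇒above {a} (m ▸ d) with walk⇒above d
... | above , e =
  +≤+ z≤n ∷ map⁺ (All.map (λ {q} → subst (0ℤ ℤ.≤_) (sym (move-height m (height q)))) above) ,
  trans (move-height m (height (steps d))) e

walk-heights : ∀ {a w c} (d : Walk a w c) → heights a (steps d) ≡ w
walk-heights stop          = refl
walk-heights (rise  ▸ d)   = cong (_ ∷_) (walk-heights d)
walk-heights (level ▸ d)   = cong (_ ∷_) (walk-heights d)
walk-heights (fall  ▸ d)   = cong (_ ∷_) (walk-heights d)

walk-length : ∀ {a w c} (d : Walk a w c) → length w ≡ suc (length (steps d))
walk-length stop    = refl
walk-length (_ ▸ d) = cong suc (walk-length d)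

steps-unique : ∀ {a w w′ c} (d : Walk a w c) (d′ : Walk a w′ c) → w ≡ w′ → steps d ≡ steps d′
steps-unique stop stop _ = refl
steps-unique stop (_ ▸ stop)    ()
steps-unique stop (_ ▸ (_ ▸ _)) ()
steps-unique (_ ▸ stop)    stop ()
steps-unique (_ ▸ (_ ▸ _)) stop ()
steps-unique (m ▸ d) (m′ ▸ d′) e with walk-head d | walk-head d′ | ∷-injectiveʳ e
... | _ , refl | _ , refl | refl = cong₂ _∷_ (move-unique m m′) (steps-unique d d′ refl)

motzkin⇒walk : ∀ {k p} → IsMotzkinPath k p → Σ (Walk 0 (heights 0 p) 0) λ d → steps d ≡ p
motzkin⇒walk {p = p} (_ , above , ends) =
  above⇒walk 0 p 0 (All.map (λ {q} → subst (0ℤ ℤ.≤_) (sym (ℤP.+-identityˡ (height q)))) above)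
                   (trans (ℤP.+-identityˡ (height p)) ends)

walk⇒motzkin : ∀ {k w} (d : Walk 0 w 0) → length w ≡ suc k → IsMotzkinPath k (steps d)
walk⇒motzkin d len with walk⇒above d
... | above , ends =
  suc-injective (trans (sym (walk-length d)) len) ,
  All.map (λ {q} → subst (0ℤ ℤ.≤_) (ℤP.+-identityˡ (height q))) above ,
  trans (sym (ℤP.+-identityˡ (height (steps d)))) ends

motzkin-bijection : (k : ℕ) → Σ (List Step → Word) λ f →
    (∀ p → IsMotzkinPath k p → Motz (f p) × length (f p) ≡ suc k)
  × (∀ p q → IsMotzkinPath k p → IsMotzkinPath k q → f p ≡ f q → p ≡ q)
  × (∀ x → Motz x → length x ≡ suc k → ∃ λ p → IsMotzkinPath k p × f p ≡ x)
motzkin-bijection k = heights 0 , into , injective , onto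
  where
  into : ∀ p → IsMotzkinPath k p → Motz (heights 0 p) × length (heights 0 p) ≡ suc k
  into p mp = walk-Motz (proj₁ (motzkin⇒walk mp)) , trans (heights-length 0 p) (cong suc (proj₁ mp))

  injective : ∀ p q → IsMotzkinPath k p → IsMotzkinPath k q → heights 0 p ≡ heights 0 q → p ≡ q
  injective p q mp mq e with motzkin⇒walk mp | motzkin⇒walk mq
  ... | d , steps≡p | d′ , steps≡q = begin
    p          ≡⟨ sym steps≡p ⟩
    steps d    ≡⟨ steps-unique d d′ e ⟩
    steps d′   ≡⟨ steps≡q ⟩
    q          ∎

  onto : ∀ x → Motz x → length x ≡ suc k → ∃ λ p → IsMotzkinPath k p × heights 0 p ≡ x
  onto x mx len = steps d , walk⇒motzkin d len , walk-heights d
    where d = Motz-walk mx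

mainTheorem6 :
    ((x : Word) → Motz x ⇔ IsMotzWord x)
    × ((k : ℕ) → Σ (List Step → Word) λ f →
         (∀ p → IsMotzkinPath k p → Motz (f p) × length (f p) ≡ suc k)
         × (∀ p q → IsMotzkinPath k p → IsMotzkinPath k q → f p ≡ f q → p ≡ q)
         × (∀ x → Motz x → length x ≡ suc k →
              ∃ λ p → IsMotzkinPath k p × f p ≡ x))
    × (∃ λ (φ : Tree → Word) → IsPresentationIso φ)
mainTheorem6 = Motz⇔MotzWord , motzkin-bijection , (φ , φ-presentation)
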